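{- Let $\mathcal{M}$ be a cartesian category, regarded as acting on itself via the cartesian product. Then the category $[\mathcal{M},\mathcal{M}]_{\mathsf{cst}}$ of costrong endofunctors on $\mathcal{M}$ and costrong natural transformations is isomorphic to the category $[\mathcal{M},\mathcal{M}]\downarrow\mathsf{id}_{\mathcal{M}}$ of copointed endofunctors on $\mathcal{M}$ and copointed natural transformations.
   Context: A costrong endofunctor on $\mathcal{M}$ (for the action of $(\mathcal{M},\times,\mathbb{1})$ on itself by $\times$) is a functor $F:\mathcal{M}\to\mathcal{M}$ with a natural transformation $\mathsf{cst}_{M,X}:F(M\times X)\to M\times F(X)$ such that (writing associativity and unit isomorphisms of $\times$ unlabelled) $\mathsf{cst}_{M\times N,X}\circ F(\cong)=\cong\circ(\mathsf{id}_M\times\mathsf{cst}_{N,X})\circ\mathsf{cst}_{M,N\times X}$ as maps $F(M\times(N\times X))\to(M\times N)\times F(X)$, and $F(\mathbb{1}\times X)\xrightarrow{\mathsf{cst}}\mathbb{1}\times F(X)\cong F(X)$ equals $F(\mathbb{1}\times X\cong X)$. A costrong natural transformation $\alpha:(F,\mathsf{cst})\to(G,\mathsf{cst})$ is a natural transformation $\alpha:F\to G$ with $\mathsf{cst}^G_{M,X}\circ\alpha_{M\times X}=(\mathsf{id}_M\times\alpha_X)\circ\mathsf{cst}^F_{M,X}$. A copointed endofunctor is a pair $(F,\epsilon)$ with $F:\mathcal{M}\to\mathcal{M}$ a functor and $\epsilon:F\to\mathsf{id}_{\mathcal{M}}$ a natural transformation; a copointed natural transformation $\alpha:(F,\epsilon)\to(G,\epsilon')$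 is a natural transformation $\alpha:F\to G$ with $\epsilon'\circ\alpha=\epsilon$. -}

module Defs where

open import Level using (Level; _⊔_) renaming (suc to lsuc)
open import Relation.Binary using (IsEquivalence; Setoid)
open import Relation.Binary.PropositionalEquality using (_≡_; refl)
open import Data.Product using (Σ; _,_)
import Data.Product
import Relation.Binary.Reasoning.Setoid as SetoidR

record Category (o ℓ e : Level) : Set (lsuc (o ⊔ ℓ ⊔ e)) where
  infix  4 _≈_ _⇒_
  infixr 9 _∘_
  field
    Obj : Set o
    _⇒_ : Obj → Obj → Set ℓ
    _≈_ : ∀ {A B} → A ⇒ B → A ⇒ B → Set e
    id  : ∀ {A} → A ⇒ A
    _∘_ : ∀ {A B C} → B ⇒ C → A ⇒ B → A ⇒ C
    assoc     : ∀ {A B C D} {f : A ⇒ B} {g : B ⇒ C} {h : C ⇒ D} →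
                (h ∘ g) ∘ f ≈ h ∘ (g ∘ f)
    identityˡ : ∀ {A B} {f : A ⇒ B} → id ∘ f ≈ f
    identityʳ : ∀ {A B} {f : A ⇒ B} → f ∘ id ≈ f
    equiv     : ∀ {A B} → IsEquivalence (_≈_ {A} {B})
    ∘-resp-≈  : ∀ {A B C} {f h : B ⇒ C} {g i : A ⇒ B} →
                f ≈ h → g ≈ i → f ∘ g ≈ h ∘ i

  hom-setoid : ∀ {A B} → Setoid ℓ e
  hom-setoid {A} {B} = record { Carrier = A ⇒ B ; _≈_ = _≈_ ; isEquivalence = equiv }

  module Eq {A B : Obj} = IsEquivalence (equiv {A} {B})

record Functor {o ℓ e o′ ℓ′ e′ : Level}
               (C : Category o ℓ e) (D : Category o′ ℓ′ e′)
               : Set (o ⊔ ℓ ⊔ e ⊔ o′ ⊔ ℓ′ ⊔ e′) where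
  private
    module C = Category C
    module D = Category D
  field
    F₀ : C.Obj → D.Obj
    F₁ : ∀ {A B} → A C.⇒ B → F₀ A D.⇒ F₀ B
    identity     : ∀ {A} → F₁ (C.id {A}) D.≈ D.id
    homomorphism : ∀ {X Y Z} {f : X C.⇒ Y} {g : Y C.⇒ Z} →
                   F₁ (g C.∘ f) D.≈ F₁ g D.∘ F₁ f
    F-resp-≈     : ∀ {A B} {f g : A C.⇒ B} → f C.≈ g → F₁ f D.≈ F₁ g

idF : ∀ {o ℓ e} {C : Category o ℓ e} → Functor C C
idF {C = C} = record
  { F₀ = λ A → A ; F₁ = λ f → f
  ; identity = Eq.refl ; homomorphism = Eq.refl ; F-resp-≈ = λ p → p }
  where open Category C

record NatTrans {o ℓ e o′ ℓ′ e′ : Level}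
                {C : Category o ℓ e} {D : Category o′ ℓ′ e′}
                (F G : Functor C D) : Set (o ⊔ ℓ ⊔ ℓ′ ⊔ e′) where
  private
    module C = Category C
    module D = Category D
    module F = Functor F
    module G = Functor G
  field
    η       : ∀ X → F.F₀ X D.⇒ G.F₀ X
    commute : ∀ {X Y} (f : X C.⇒ Y) → η Y D.∘ F.F₁ f D.≈ G.F₁ f D.∘ η X

record Cartesian {o ℓ e : Level} (C : Category o ℓ e) : Set (o ⊔ ℓ ⊔ e) where
  open Category C
  infixr 7 _×_
  infixr 8 _⁂_
  field
    ⊤        : Obj
    !        : ∀ {A} → A ⇒ ⊤
    !-unique : ∀ {A} (f : A ⇒ ⊤) → ! ≈ f
    _×_      : Obj → Obj → Obj
    π₁       : ∀ {A B} → A × B ⇒ A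
    π₂       : ∀ {A B} → A × B ⇒ B
    ⟨_,_⟩    : ∀ {X A B} → X ⇒ A → X ⇒ B → X ⇒ A × B
    project₁ : ∀ {X A B} {f : X ⇒ A} {g : X ⇒ B} → π₁ ∘ ⟨ f , g ⟩ ≈ f
    project₂ : ∀ {X A B} {f : X ⇒ A} {g : X ⇒ B} → π₂ ∘ ⟨ f , g ⟩ ≈ g
    unique   : ∀ {X A B} {h : X ⇒ A × B} {f : X ⇒ A} {g : X ⇒ B} →
               π₁ ∘ h ≈ f → π₂ ∘ h ≈ g → ⟨ f , g ⟩ ≈ h

  _⁂_ : ∀ {A B C D} → A ⇒ B → C ⇒ D → A × C ⇒ B × D
  f ⁂ g = ⟨ f ∘ π₁ , g ∘ π₂ ⟩

  assocʳ : ∀ {A B D} → A × (B × D) ⇒ (A × B) × D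
  assocʳ = ⟨ ⟨ π₁ , π₁ ∘ π₂ ⟩ , π₂ ∘ π₂ ⟩

  unitorˡ : ∀ {A} → ⊤ × A ⇒ A
  unitorˡ = π₂

  private
    module R {A B} = SetoidR (hom-setoid {A} {B})

  ⟨⟩-cong : ∀ {X A B} {f f′ : X ⇒ A} {g g′ : X ⇒ B} →
            f ≈ f′ → g ≈ g′ → ⟨ f , g ⟩ ≈ ⟨ f′ , g′ ⟩
  ⟨⟩-cong p q = unique (Eq.trans project₁ (Eq.sym p)) (Eq.trans project₂ (Eq.sym q))

  ⁂-id : ∀ {A B} → id {A} ⁂ id {B} ≈ id
  ⁂-id = unique (Eq.trans identityʳ (Eq.sym identityˡ))
                (Eq.trans identityʳ (Eq.sym identityˡ))

  ⁂-∘ : ∀ {A B C D E F} {f : B ⇒ C} {g : E ⇒ F} {h : A ⇒ B} {k : D ⇒ E} →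
        (f ∘ h) ⁂ (g ∘ k) ≈ (f ⁂ g) ∘ (h ⁂ k)
  ⁂-∘ {f = f} {g} {h} {k} = unique p q
    where
    p : π₁ ∘ ((f ⁂ g) ∘ (h ⁂ k)) ≈ (f ∘ h) ∘ π₁
    p = R.begin
          π₁ ∘ ((f ⁂ g) ∘ (h ⁂ k))  R.≈⟨ Eq.sym assoc ⟩
          (π₁ ∘ (f ⁂ g)) ∘ (h ⁂ k)  R.≈⟨ ∘-resp-≈ project₁ Eq.refl ⟩
          (f ∘ π₁) ∘ (h ⁂ k)        R.≈⟨ assoc ⟩
          f ∘ (π₁ ∘ (h ⁂ k))        R.≈⟨ ∘-resp-≈ Eq.refl project₁ ⟩
          f ∘ (h ∘ π₁)              R.≈⟨ Eq.sym assoc ⟩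
          (f ∘ h) ∘ π₁              R.∎
    q : π₂ ∘ ((f ⁂ g) ∘ (h ⁂ k)) ≈ (g ∘ k) ∘ π₂
    q = R.begin
          π₂ ∘ ((f ⁂ g) ∘ (h ⁂ k))  R.≈⟨ Eq.sym assoc ⟩
          (π₂ ∘ (f ⁂ g)) ∘ (h ⁂ k)  R.≈⟨ ∘-resp-≈ project₂ Eq.refl ⟩
          (g ∘ π₂) ∘ (h ⁂ k)        R.≈⟨ assoc ⟩
          g ∘ (π₂ ∘ (h ⁂ k))        R.≈⟨ ∘-resp-≈ Eq.refl project₂ ⟩
          g ∘ (k ∘ π₂)              R.≈⟨ Eq.sym assoc ⟩
          (g ∘ k) ∘ π₂              R.∎

module EndoCats {o ℓ e : Level} (𝓜 : Category o ℓ e) (cart : Cartesian 𝓜) where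
  open Category 𝓜
  open Cartesian cart
  private
    module R {A B} = SetoidR (hom-setoid {A} {B})

  Endo : Set (o ⊔ ℓ ⊔ e)
  Endo = Functor 𝓜 𝓜

  record Costrength (F : Endo) : Set (o ⊔ ℓ ⊔ e) where
    open Functor F
    field
      cst     : ∀ M X → F₀ (M × X) ⇒ M × F₀ X
      natural : ∀ {M M′ X X′} (f : M ⇒ M′) (g : X ⇒ X′) →
                cst M′ X′ ∘ F₁ (f ⁂ g) ≈ (f ⁂ F₁ g) ∘ cst M X
      assoc-law : ∀ M N X →
                cst (M × N) X ∘ F₁ assocʳ ≈ assocʳ ∘ ((id ⁂ cst N X) ∘ cst M (N × X))
      unit-law : ∀ X → unitorˡ ∘ cst ⊤ X ≈ F₁ unitorˡ

  record CostrongEndo : Set (o ⊔ ℓ ⊔ e) where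
    field
      F          : Endo
      costrength : Costrength F
    open Functor F public
    open Costrength costrength public

  record CostrongNT (A B : CostrongEndo) : Set (o ⊔ ℓ ⊔ e) where
    private
      module A = CostrongEndo A
      module B = CostrongEndo B
    field
      α       : NatTrans A.F B.F
    open NatTrans α public
    field
      cst-commute : ∀ M X → B.cst M X ∘ η (M × X) ≈ (id ⁂ η X) ∘ A.cst M X

  record CopointedEndo : Set (o ⊔ ℓ ⊔ e) where
    field
      F : Endo
      ε : NatTrans F idF
    open Functor F public

  record CopointedNT (A B : CopointedEndo) : Set (o ⊔ ℓ ⊔ e) where
    private
      module A = CopointedEndo A
      module B = CopointedEndo B
    field
      α : NatTrans A.F B.F
    open NatTrans α public
    field
      ε-commute : ∀ X → NatTrans.η B.ε X ∘ η X ≈ NatTrans.η A.ε X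

  idNT : ∀ {F : Endo} → NatTrans F F
  idNT {F} = record
    { η = λ X → id
    ; commute = λ f → Eq.trans identityˡ (Eq.sym identityʳ) }

  _∘NT_ : ∀ {F G H : Endo} → NatTrans G H → NatTrans F G → NatTrans F H
  _∘NT_ {F} {G} {H} β α = record
    { η = λ X → β.η X ∘ α.η X
    ; commute = λ {X} {Y} f → R.begin
        (β.η Y ∘ α.η Y) ∘ F.F₁ f   R.≈⟨ assoc ⟩
        β.η Y ∘ (α.η Y ∘ F.F₁ f)   R.≈⟨ ∘-resp-≈ Eq.refl (α.commute f) ⟩
        β.η Y ∘ (G.F₁ f ∘ α.η X)   R.≈⟨ Eq.sym assoc ⟩
        (β.η Y ∘ G.F₁ f) ∘ α.η X   R.≈⟨ ∘-resp-≈ (β.commute f) Eq.refl ⟩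
        (H.F₁ f ∘ β.η X) ∘ α.η X   R.≈⟨ assoc ⟩
        H.F₁ f ∘ (β.η X ∘ α.η X)   R.∎ }
    where
    module α = NatTrans α
    module β = NatTrans β
    module F = Functor F
    module G = Functor G
    module H = Functor H

  CostrongCat : Category (o ⊔ ℓ ⊔ e) (o ⊔ ℓ ⊔ e) (o ⊔ e)
  CostrongCat = record
    { Obj = CostrongEndo
    ; _⇒_ = CostrongNT
    ; _≈_ = λ a b → ∀ X → CostrongNT.η a X ≈ CostrongNT.η b X
    ; id  = λ {A} → record
        { α = idNT
        ; cst-commute = λ M X → Eq.trans identityʳ
            (Eq.sym (Eq.trans (∘-resp-≈ ⁂-id Eq.refl) identityˡ)) }
    ; _∘_ = λ {A} {B} {C} b a →
        let module A = CostrongEndo A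
            module B = CostrongEndo B
            module C = CostrongEndo C
            module a = CostrongNT a
            module b = CostrongNT b
        in record
        { α = b.α ∘NT a.α
        ; cst-commute = λ M X → R.begin
            C.cst M X ∘ (b.η (M × X) ∘ a.η (M × X))
              R.≈⟨ Eq.sym assoc ⟩
            (C.cst M X ∘ b.η (M × X)) ∘ a.η (M × X)
              R.≈⟨ ∘-resp-≈ (b.cst-commute M X) Eq.refl ⟩
            ((id ⁂ b.η X) ∘ B.cst M X) ∘ a.η (M × X)
              R.≈⟨ assoc ⟩
            (id ⁂ b.η X) ∘ (B.cst M X ∘ a.η (M × X))
              R.≈⟨ ∘-resp-≈ Eq.refl (a.cst-commute M X) ⟩
            (id ⁂ b.η X) ∘ ((id ⁂ a.η X) ∘ A.cst M X)
              R.≈⟨ Eq.sym assoc ⟩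
            ((id ⁂ b.η X) ∘ (id ⁂ a.η X)) ∘ A.cst M X
              R.≈⟨ ∘-resp-≈ (Eq.sym ⁂-∘) Eq.refl ⟩
            ((id ∘ id) ⁂ (b.η X ∘ a.η X)) ∘ A.cst M X
              R.≈⟨ ∘-resp-≈ (⟨⟩-cong (∘-resp-≈ identityˡ Eq.refl) Eq.refl) Eq.refl ⟩
            (id ⁂ (b.η X ∘ a.η X)) ∘ A.cst M X
              R.∎ }
    ; assoc     = λ X → assoc
    ; identityˡ = λ X → identityˡ
    ; identityʳ = λ X → identityʳ
    ; equiv = record
        { refl  = λ X → Eq.refl
        ; sym   = λ p X → Eq.sym (p X)
        ; trans = λ p q X → Eq.trans (p X) (q X) }
    ; ∘-resp-≈ = λ p q X → ∘-resp-≈ (p X) (q X)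
    }

  CopointedCat : Category (o ⊔ ℓ ⊔ e) (o ⊔ ℓ ⊔ e) (o ⊔ e)
  CopointedCat = record
    { Obj = CopointedEndo
    ; _⇒_ = CopointedNT
    ; _≈_ = λ a b → ∀ X → CopointedNT.η a X ≈ CopointedNT.η b X
    ; id  = λ {A} → record { α = idNT ; ε-commute = λ X → identityʳ }
    ; _∘_ = λ {A} {B} {C} b a →
        let module a = CopointedNT a
            module b = CopointedNT b
            module C = CopointedEndo C
        in record
        { α = b.α ∘NT a.α
        ; ε-commute = λ X → R.begin
            NatTrans.η C.ε X ∘ (b.η X ∘ a.η X)   R.≈⟨ Eq.sym assoc ⟩
            (NatTrans.η C.ε X ∘ b.η X) ∘ a.η X   R.≈⟨ ∘-resp-≈ (b.ε-commute X) Eq.refl ⟩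
            NatTrans.η (CopointedEndo.ε B) X ∘ a.η X R.≈⟨ a.ε-commute X ⟩
            NatTrans.η (CopointedEndo.ε A) X     R.∎ }
    ; assoc     = λ X → assoc
    ; identityˡ = λ X → identityˡ
    ; identityʳ = λ X → identityʳ
    ; equiv = record
        { refl  = λ X → Eq.refl
        ; sym   = λ p X → Eq.sym (p X)
        ; trans = λ p q X → Eq.trans (p X) (q X) }
    ; ∘-resp-≈ = λ p q X → ∘-resp-≈ (p X) (q X)
    }

  SameCst : {F G : Endo} → F ≡ G → Costrength F → Costrength G → Set (o ⊔ e)
  SameCst refl c d = ∀ M X → Costrength.cst c M X ≈ Costrength.cst d M X

  SameCop : {F G : Endo} → F ≡ G → NatTrans F idF → NatTrans G idF → Set (o ⊔ e)
  SameCop refl ε ε′ = ∀ X → NatTrans.η ε X ≈ NatTrans.η ε′ X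

  NTOver : {F F′ G G′ : Endo} → F ≡ F′ → G ≡ G′ →
           NatTrans F G → NatTrans F′ G′ → Set (o ⊔ e)
  NTOver refl refl a b = ∀ X → NatTrans.η a X ≈ NatTrans.η b X

  _≐cst_ : CostrongEndo → CostrongEndo → Set (o ⊔ ℓ ⊔ e)
  A ≐cst B = Σ (CostrongEndo.F A ≡ CostrongEndo.F B) λ p →
               SameCst p (CostrongEndo.costrength A) (CostrongEndo.costrength B)

  _≐cop_ : CopointedEndo → CopointedEndo → Set (o ⊔ ℓ ⊔ e)
  A ≐cop B = Σ (CopointedEndo.F A ≡ CopointedEndo.F B) λ p →
               SameCop p (CopointedEndo.ε A) (CopointedEndo.ε B)

  record CostrongCopointedIso : Set (o ⊔ ℓ ⊔ e) where
    field
      Φ : Functor CostrongCat CopointedCat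
      Ψ : Functor CopointedCat CostrongCat
    private
      module Φ = Functor Φ
      module Ψ = Functor Ψ
    field
      ΨΦ-obj : ∀ A → Ψ.F₀ (Φ.F₀ A) ≐cst A
      ΨΦ-hom : ∀ {A B} (f : CostrongNT A B) →
               NTOver (Data.Product.proj₁ (ΨΦ-obj A)) (Data.Product.proj₁ (ΨΦ-obj B))
                      (CostrongNT.α (Ψ.F₁ (Φ.F₁ f))) (CostrongNT.α f)
      ΦΨ-obj : ∀ A → Φ.F₀ (Ψ.F₀ A) ≐cop A
      ΦΨ-hom : ∀ {A B} (f : CopointedNT A B) →
               NTOver (Data.Product.proj₁ (ΦΨ-obj A)) (Data.Product.proj₁ (ΦΨ-obj B))
                      (CopointedNT.α (Φ.F₁ (Ψ.F₁ f))) (CopointedNT.α f)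

{-# OPTIONS --safe #-}
module Submission where

open import Relation.Binary.PropositionalEquality using (refl)
open import Data.Product using (_,_)
import Relation.Binary.Reasoning.Setoid as SetoidReasoning
open import Defs

-- A costrength is determined by its counit  ε_X = π₁ ∘ cst_{X,𝟙} ∘ F ⟨ id , ! ⟩:
-- the unit law and naturality along  ! ⁂ id  force  π₂ ∘ cst_{M,X} = F π₂,  and
-- naturality along  id ⁂ !  and  π₁ ⁂ id  force  π₁ ∘ cst_{M,X} = π₁ ∘ ε_{M × X}.  Conversely every copoint ε
-- yields the costrength  ⟨ π₁ ∘ ε_{M × X} , F π₂ ⟩.  Both constructions keep the
-- underlying functor and natural transformations, so they are mutually inverse
-- on morphisms as soon as they are on objects.

module HomReasoning {o ℓ e} (𝓒 : Category o ℓ e) where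
  open Category 𝓒

  module _ {A B : Obj} where
    open SetoidReasoning (hom-setoid {A} {B}) public

  ∘-resp-≈ˡ : ∀ {A B C} {f g : B ⇒ C} {h : A ⇒ B} → f ≈ g → f ∘ h ≈ g ∘ h
  ∘-resp-≈ˡ p = ∘-resp-≈ p Eq.refl

  ∘-resp-≈ʳ : ∀ {A B C} {f : B ⇒ C} {g h : A ⇒ B} → g ≈ h → f ∘ g ≈ f ∘ h
  ∘-resp-≈ʳ p = ∘-resp-≈ Eq.refl p

  pullˡ : ∀ {W X Y Z} {a : Y ⇒ Z} {b : X ⇒ Y} {c : X ⇒ Z} {f : W ⇒ X} →
          a ∘ b ≈ c → a ∘ b ∘ f ≈ c ∘ f
  pullˡ p = Eq.trans (Eq.sym assoc) (∘-resp-≈ˡ p)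

  pullʳ : ∀ {W X Y Z} {a : X ⇒ Y} {b : W ⇒ X} {c : W ⇒ Y} {f : Y ⇒ Z} →
          a ∘ b ≈ c → (f ∘ a) ∘ b ≈ f ∘ c
  pullʳ p = Eq.trans assoc (∘-resp-≈ʳ p)

module _ {o ℓ e o′ ℓ′ e′} {𝓒 : Category o ℓ e} {𝓓 : Category o′ ℓ′ e′}
         (F : Functor 𝓒 𝓓) where
  private
    module 𝓒 = Category 𝓒
    module 𝓓 = Category 𝓓
  open Functor F

  [_]-resp-∘ : ∀ {A B C} {f : B 𝓒.⇒ C} {g : A 𝓒.⇒ B} {h : A 𝓒.⇒ C} →
               f 𝓒.∘ g 𝓒.≈ h → F₁ f 𝓓.∘ F₁ g 𝓓.≈ F₁ h
  [_]-resp-∘ p = 𝓓.Eq.trans (𝓓.Eq.sym homomorphism) (F-resp-≈ p)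

  [_]-resp-square : ∀ {A B C D} {f : B 𝓒.⇒ D} {g : A 𝓒.⇒ B} {h : C 𝓒.⇒ D} {i : A 𝓒.⇒ C} →
                    f 𝓒.∘ g 𝓒.≈ h 𝓒.∘ i → F₁ f 𝓓.∘ F₁ g 𝓓.≈ F₁ h 𝓓.∘ F₁ i
  [_]-resp-square p = 𝓓.Eq.trans ([_]-resp-∘ p) homomorphism

module CartesianLemmas {o ℓ e} {𝓒 : Category o ℓ e} (cart : Cartesian 𝓒) where
  open Category 𝓒
  open Cartesian cart
  open HomReasoning 𝓒

  !-unique₂ : ∀ {A} (f g : A ⇒ ⊤) → f ≈ g
  !-unique₂ f g = Eq.trans (Eq.sym (!-unique f)) (!-unique g)

  ⟨⟩∘ : ∀ {W X A B} {f : X ⇒ A} {g : X ⇒ B} {h : W ⇒ X} →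
        ⟨ f , g ⟩ ∘ h ≈ ⟨ f ∘ h , g ∘ h ⟩
  ⟨⟩∘ = Eq.sym (unique (pullˡ project₁) (pullˡ project₂))

  ⁂∘⟨⟩ : ∀ {X A B C D} {f : A ⇒ B} {g : C ⇒ D} {h : X ⇒ A} {k : X ⇒ C} →
         (f ⁂ g) ∘ ⟨ h , k ⟩ ≈ ⟨ f ∘ h , g ∘ k ⟩
  ⁂∘⟨⟩ = Eq.trans ⟨⟩∘ (⟨⟩-cong (pullʳ project₁) (pullʳ project₂))

  assocʳ∘⟨⟨⟩⟩ : ∀ {X A B C} {f : X ⇒ A} {g : X ⇒ B} {h : X ⇒ C} →
                assocʳ ∘ ⟨ f , ⟨ g , h ⟩ ⟩ ≈ ⟨ ⟨ f , g ⟩ , h ⟩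
  assocʳ∘⟨⟨⟩⟩ = Eq.trans ⟨⟩∘ (⟨⟩-cong
    (Eq.trans ⟨⟩∘ (⟨⟩-cong project₁ (Eq.trans (pullʳ project₂) project₁)))
    (Eq.trans (pullʳ project₂) project₂))

  unitorʳ⁻¹ : ∀ {A} → A ⇒ A × ⊤
  unitorʳ⁻¹ = ⟨ id , ! ⟩

  unitorʳ⁻¹-natural : ∀ {A B} (f : A ⇒ B) → unitorʳ⁻¹ ∘ f ≈ (f ⁂ id) ∘ unitorʳ⁻¹
  unitorʳ⁻¹-natural f = begin
    ⟨ id , ! ⟩ ∘ f          ≈⟨ ⟨⟩∘ ⟩
    ⟨ id ∘ f , ! ∘ f ⟩      ≈⟨ ⟨⟩-cong (Eq.trans identityˡ (Eq.sym identityʳ)) (!-unique₂ _ _) ⟩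
    ⟨ f ∘ id , id ∘ ! ⟩     ≈⟨ ⁂∘⟨⟩ ⟨
    (f ⁂ id) ∘ ⟨ id , ! ⟩   ∎

  π₁⁂id∘unitorʳ⁻¹ : ∀ {A B} → (π₁ ⁂ id) ∘ unitorʳ⁻¹ ≈ id {A} ⁂ ! {B}
  π₁⁂id∘unitorʳ⁻¹ = Eq.trans ⁂∘⟨⟩
    (⟨⟩-cong (Eq.trans identityʳ (Eq.sym identityˡ)) (!-unique₂ _ _))

module CostrongCopointed {o ℓ e} (𝓜 : Category o ℓ e) (cart : Cartesian 𝓜) where
  open Category 𝓜
  open Cartesian cart
  open EndoCats 𝓜 cart
  open HomReasoning 𝓜
  open CartesianLemmas cart

  module CounitOfCostrength {F : Endo} (c : Costrength F) where
    open Functor F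
    open Costrength c

    π₁∘cst-natural : ∀ {M M′ X X′} (f : M ⇒ M′) (g : X ⇒ X′) →
                     (π₁ ∘ cst M′ X′) ∘ F₁ (f ⁂ g) ≈ f ∘ π₁ ∘ cst M X
    π₁∘cst-natural f g = begin
      (π₁ ∘ cst _ _) ∘ F₁ (f ⁂ g)   ≈⟨ pullʳ (natural f g) ⟩
      π₁ ∘ (f ⁂ F₁ g) ∘ cst _ _     ≈⟨ pullˡ project₁ ⟩
      (f ∘ π₁) ∘ cst _ _            ≈⟨ assoc ⟩
      f ∘ π₁ ∘ cst _ _              ∎

    π₂∘cst-natural : ∀ {M M′ X X′} (f : M ⇒ M′) (g : X ⇒ X′) →
                     (π₂ ∘ cst M′ X′) ∘ F₁ (f ⁂ g) ≈ F₁ g ∘ π₂ ∘ cst M X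
    π₂∘cst-natural f g = begin
      (π₂ ∘ cst _ _) ∘ F₁ (f ⁂ g)   ≈⟨ pullʳ (natural f g) ⟩
      π₂ ∘ (f ⁂ F₁ g) ∘ cst _ _     ≈⟨ pullˡ project₂ ⟩
      (F₁ g ∘ π₂) ∘ cst _ _         ≈⟨ assoc ⟩
      F₁ g ∘ π₂ ∘ cst _ _           ∎

    counit : NatTrans F idF
    counit = record
      { η       = λ X → (π₁ ∘ cst X ⊤) ∘ F₁ unitorʳ⁻¹
      ; commute = λ f → begin
          ((π₁ ∘ cst _ ⊤) ∘ F₁ unitorʳ⁻¹) ∘ F₁ f
            ≈⟨ pullʳ ([ F ]-resp-square (unitorʳ⁻¹-natural f)) ⟩
          (π₁ ∘ cst _ ⊤) ∘ F₁ (f ⁂ id) ∘ F₁ unitorʳ⁻¹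
            ≈⟨ pullˡ (π₁∘cst-natural f id) ⟩
          (f ∘ π₁ ∘ cst _ ⊤) ∘ F₁ unitorʳ⁻¹
            ≈⟨ assoc ⟩
          f ∘ (π₁ ∘ cst _ ⊤) ∘ F₁ unitorʳ⁻¹
            ∎ }

    private
      module counit = NatTrans counit

    π₁∘cst≈π₁∘counit : ∀ M X → π₁ ∘ cst M X ≈ π₁ ∘ counit.η (M × X)
    π₁∘cst≈π₁∘counit M X = begin
      π₁ ∘ cst M X                                             ≈⟨ identityˡ ⟨
      id ∘ π₁ ∘ cst M X                                        ≈⟨ π₁∘cst-natural id ! ⟨
      (π₁ ∘ cst M ⊤) ∘ F₁ (id ⁂ !)                             ≈⟨ ∘-resp-≈ʳ ([ F ]-resp-∘ π₁⁂id∘unitorʳ⁻¹) ⟨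
      (π₁ ∘ cst M ⊤) ∘ F₁ (π₁ ⁂ id) ∘ F₁ unitorʳ⁻¹             ≈⟨ pullˡ (π₁∘cst-natural π₁ id) ⟩
      (π₁ ∘ π₁ ∘ cst (M × X) ⊤) ∘ F₁ unitorʳ⁻¹                 ≈⟨ assoc ⟩
      π₁ ∘ (π₁ ∘ cst (M × X) ⊤) ∘ F₁ unitorʳ⁻¹                 ∎

    π₂∘cst≈F₁π₂ : ∀ M X → π₂ ∘ cst M X ≈ F₁ π₂
    π₂∘cst≈F₁π₂ M X = begin
      π₂ ∘ cst M X                   ≈⟨ identityˡ ⟨
      id ∘ π₂ ∘ cst M X              ≈⟨ ∘-resp-≈ˡ identity ⟨
      F₁ id ∘ π₂ ∘ cst M X           ≈⟨ π₂∘cst-natural ! id ⟨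
      (π₂ ∘ cst ⊤ X) ∘ F₁ (! ⁂ id)   ≈⟨ ∘-resp-≈ˡ (unit-law X) ⟩
      F₁ π₂ ∘ F₁ (! ⁂ id)            ≈⟨ [ F ]-resp-∘ (Eq.trans project₂ identityˡ) ⟩
      F₁ π₂                          ∎

  module CostrengthOfCounit {F : Endo} (ε : NatTrans F idF) where
    open Functor F
    private
      module ε = NatTrans ε

    π₁∘ε-natural : ∀ {X A B} (h : X ⇒ A × B) → (π₁ ∘ ε.η (A × B)) ∘ F₁ h ≈ (π₁ ∘ h) ∘ ε.η X
    π₁∘ε-natural h = Eq.trans (pullʳ (ε.commute h)) (Eq.sym assoc)

    cst : ∀ M X → F₀ (M × X) ⇒ M × F₀ X
    cst M X = ⟨ π₁ ∘ ε.η (M × X) , F₁ π₂ ⟩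

    natural : ∀ {M M′ X X′} (f : M ⇒ M′) (g : X ⇒ X′) →
              cst M′ X′ ∘ F₁ (f ⁂ g) ≈ (f ⁂ F₁ g) ∘ cst M X
    natural f g = begin
      cst _ _ ∘ F₁ (f ⁂ g)                                           ≈⟨ ⟨⟩∘ ⟩
      ⟨ (π₁ ∘ ε.η _) ∘ F₁ (f ⁂ g) , F₁ π₂ ∘ F₁ (f ⁂ g) ⟩             ≈⟨ ⟨⟩-cong first ([ F ]-resp-square project₂) ⟩
      ⟨ f ∘ π₁ ∘ ε.η _ , F₁ g ∘ F₁ π₂ ⟩                              ≈⟨ ⁂∘⟨⟩ ⟨
      (f ⁂ F₁ g) ∘ cst _ _                                           ∎
      where
      first : (π₁ ∘ ε.η _) ∘ F₁ (f ⁂ g) ≈ f ∘ π₁ ∘ ε.η _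
      first = Eq.trans (π₁∘ε-natural (f ⁂ g)) (Eq.trans (∘-resp-≈ˡ project₁) assoc)

    assoc-law : ∀ M N X →
                cst (M × N) X ∘ F₁ assocʳ ≈ assocʳ ∘ (id ⁂ cst N X) ∘ cst M (N × X)
    assoc-law M N X = begin
      cst (M × N) X ∘ F₁ assocʳ                                      ≈⟨ ⟨⟩∘ ⟩
      ⟨ (π₁ ∘ ε.η _) ∘ F₁ assocʳ , F₁ π₂ ∘ F₁ assocʳ ⟩               ≈⟨ ⟨⟩-cong first ([ F ]-resp-square project₂) ⟩
      ⟨ ⟨ π₁ ∘ ε₀ , (π₁ ∘ π₂) ∘ ε₀ ⟩ , F₁ π₂ ∘ F₁ π₂ ⟩              ≈⟨ assocʳ∘⟨⟨⟩⟩ ⟨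
      assocʳ ∘ ⟨ π₁ ∘ ε₀ , ⟨ (π₁ ∘ π₂) ∘ ε₀ , F₁ π₂ ∘ F₁ π₂ ⟩ ⟩      ≈⟨ ∘-resp-≈ʳ second ⟨
      assocʳ ∘ (id ⁂ cst N X) ∘ cst M (N × X)                        ∎
      where
      ε₀ = ε.η (M × (N × X))
      first : (π₁ ∘ ε.η _) ∘ F₁ assocʳ ≈ ⟨ π₁ ∘ ε₀ , (π₁ ∘ π₂) ∘ ε₀ ⟩
      first = Eq.trans (π₁∘ε-natural assocʳ) (Eq.trans (∘-resp-≈ˡ project₁) ⟨⟩∘)
      second : (id ⁂ cst N X) ∘ cst M (N × X) ≈ ⟨ π₁ ∘ ε₀ , ⟨ (π₁ ∘ π₂) ∘ ε₀ , F₁ π₂ ∘ F₁ π₂ ⟩ ⟩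
      second = begin
        (id ⁂ cst N X) ∘ cst M (N × X)                               ≈⟨ ⁂∘⟨⟩ ⟩
        ⟨ id ∘ π₁ ∘ ε₀ , cst N X ∘ F₁ π₂ ⟩                            ≈⟨ ⟨⟩-cong identityˡ ⟨⟩∘ ⟩
        ⟨ π₁ ∘ ε₀ , ⟨ (π₁ ∘ ε.η _) ∘ F₁ π₂ , F₁ π₂ ∘ F₁ π₂ ⟩ ⟩       ≈⟨ ⟨⟩-cong Eq.refl (⟨⟩-cong (π₁∘ε-natural π₂) Eq.refl) ⟩
        ⟨ π₁ ∘ ε₀ , ⟨ (π₁ ∘ π₂) ∘ ε₀ , F₁ π₂ ∘ F₁ π₂ ⟩ ⟩              ∎

    costrength : Costrength F
    costrength = record
      { cst = cst ; natural = natural ; assoc-law = assoc-law ; unit-law = λ X → project₂ }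

  open CounitOfCostrength using (counit; π₁∘cst≈π₁∘counit; π₂∘cst≈F₁π₂)
  open CostrengthOfCounit using (costrength; π₁∘ε-natural)

  counit-of-costrength : ∀ {F} (ε : NatTrans F idF) X →
                         NatTrans.η (counit (costrength ε)) X ≈ NatTrans.η ε X
  counit-of-costrength {F} ε X = begin
    (π₁ ∘ ⟨ π₁ ∘ ε.η (X × ⊤) , F₁ π₂ ⟩) ∘ F₁ unitorʳ⁻¹   ≈⟨ ∘-resp-≈ˡ project₁ ⟩
    (π₁ ∘ ε.η (X × ⊤)) ∘ F₁ unitorʳ⁻¹                    ≈⟨ π₁∘ε-natural ε unitorʳ⁻¹ ⟩
    (π₁ ∘ unitorʳ⁻¹) ∘ ε.η X                            ≈⟨ Eq.trans (∘-resp-≈ˡ project₁) identityˡ ⟩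
    ε.η X                                               ∎
    where
    open Functor F
    module ε = NatTrans ε

  costrength-of-counit : ∀ {F} (c : Costrength F) M X →
                         Costrength.cst (costrength (counit c)) M X ≈ Costrength.cst c M X
  costrength-of-counit c M X = unique (π₁∘cst≈π₁∘counit c M X) (π₂∘cst≈F₁π₂ c M X)

  counit-commute : ∀ {A B} (f : CostrongNT A B) X →
                   NatTrans.η (counit (CostrongEndo.costrength B)) X ∘ CostrongNT.η f X ≈
                   NatTrans.η (counit (CostrongEndo.costrength A)) X
  counit-commute {A} {B} f X = begin
    ((π₁ ∘ B.cst X ⊤) ∘ B.F₁ unitorʳ⁻¹) ∘ f.η X         ≈⟨ pullʳ (Eq.sym (f.commute unitorʳ⁻¹)) ⟩
    (π₁ ∘ B.cst X ⊤) ∘ f.η (X × ⊤) ∘ A.F₁ unitorʳ⁻¹     ≈⟨ pullˡ (pullʳ (f.cst-commute X ⊤)) ⟩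
    (π₁ ∘ (id ⁂ f.η ⊤) ∘ A.cst X ⊤) ∘ A.F₁ unitorʳ⁻¹    ≈⟨ ∘-resp-≈ˡ (Eq.trans (pullˡ project₁) (∘-resp-≈ˡ identityˡ)) ⟩
    (π₁ ∘ A.cst X ⊤) ∘ A.F₁ unitorʳ⁻¹                   ∎
    where
    module A = CostrongEndo A
    module B = CostrongEndo B
    module f = CostrongNT f

  costrength-commute : ∀ {A B} (f : CopointedNT A B) M X →
                       Costrength.cst (costrength (CopointedEndo.ε B)) M X ∘ CopointedNT.η f (M × X) ≈
                       (id ⁂ CopointedNT.η f X) ∘ Costrength.cst (costrength (CopointedEndo.ε A)) M X
  costrength-commute {A} {B} f M X = begin
    ⟨ π₁ ∘ εB.η _ , B.F₁ π₂ ⟩ ∘ f.η _                  ≈⟨ ⟨⟩∘ ⟩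
    ⟨ (π₁ ∘ εB.η _) ∘ f.η _ , B.F₁ π₂ ∘ f.η _ ⟩        ≈⟨ ⟨⟩-cong first (f.commute π₂) ⟨
    ⟨ id ∘ π₁ ∘ εA.η _ , f.η X ∘ A.F₁ π₂ ⟩             ≈⟨ ⁂∘⟨⟩ ⟨
    (id ⁂ f.η X) ∘ ⟨ π₁ ∘ εA.η _ , A.F₁ π₂ ⟩           ∎
    where
    module A = CopointedEndo A
    module B = CopointedEndo B
    module εA = NatTrans A.ε
    module εB = NatTrans B.ε
    module f = CopointedNT f
    first : id ∘ π₁ ∘ εA.η (M × X) ≈ (π₁ ∘ εB.η _) ∘ f.η _
    first = Eq.trans identityˡ (Eq.sym (pullʳ (f.ε-commute (M × X))))

  Φ : Functor CostrongCat CopointedCat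
  Φ = record
    { F₀ = λ A → record { F = CostrongEndo.F A ; ε = counit (CostrongEndo.costrength A) }
    ; F₁ = λ f → record { α = CostrongNT.α f ; ε-commute = counit-commute f }
    ; identity     = λ X → Eq.refl
    ; homomorphism = λ X → Eq.refl
    ; F-resp-≈     = λ p → p }

  Ψ : Functor CopointedCat CostrongCat
  Ψ = record
    { F₀ = λ A → record { F = CopointedEndo.F A ; costrength = costrength (CopointedEndo.ε A) }
    ; F₁ = λ f → record { α = CopointedNT.α f ; cst-commute = costrength-commute f }
    ; identity     = λ X → Eq.refl
    ; homomorphism = λ X → Eq.refl
    ; F-resp-≈     = λ p → p }

  costrong≅copointed : CostrongCopointedIso
  costrong≅copointed = record
    { Φ = Φ
    ; Ψ = Ψ
    ; ΨΦ-obj = λ A → refl , costrength-of-counit (CostrongEndo.costrength A)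
    ; ΨΦ-hom = λ f X → Eq.refl
    ; ΦΨ-obj = λ A → refl , counit-of-costrength (CopointedEndo.ε A)
    ; ΦΨ-hom = λ f X → Eq.refl }

mainTheorem2 : ∀ {o ℓ e} (𝓜 : Category o ℓ e) (cart : Cartesian 𝓜) →
    EndoCats.CostrongCopointedIso 𝓜 cart
mainTheorem2 𝓜 cart = CostrongCopointed.costrong≅copointed 𝓜 cart
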